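{- Let $0<k\leq n$ be integers. In the unique optimal (minimal-length) solution of the Tower of Hanoi-Fibonacci with $n$ disks from $(\Delta_n,\varnothing,\varnothing)$ to $(\varnothing,\varnothing,\Delta_n)$, the number of $k$-Fibonacci moves is $F_{n+1-k}$.
   Context: Fibonacci numbers: $F_1=F_2=1$, $F_{m+2}=F_{m+1}+F_m$. Disks $1,\dots,n$, $\Delta_k=\{1,\dots,k\}$ ($\varnothing$ for $k<1$). A state is an ordered triple $(A,B,C)$ of disjoint sets with union $\Delta_n$ (each peg stacked in decreasing order, top = minimum). For $k\in\Delta_n$, a $k$-Fibonacci move is defined when two distinct pegs $X,Y$ satisfy $X=k\tilde X$, $Y=\Delta_{k-1}\tilde Y$ (all disks of $\tilde X,\tilde Y$ larger than $k$) and the third peg $Z$ contains only disks larger than $k$; it yields $\tilde{X}\sqcup \Delta_{k-2}\tilde{Y}\sqcup (k-1)kZ$ (disks $k-1,k$ put simultaneously onto $Z$; peg positions preserved). The Tower of Hanoi-Fibonacci allows only such moves; its minimal solution from $(\Delta_n,\varnothing,\varnothing)$ to $(\varnothing,\varnothing,\Delta_n)$ is unique. -}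

module Defs where

open import Data.Nat using (ℕ; zero; suc; _+_; _≤_; _<_; _≟_)
open import Relation.Nullary using (yes; no)
open import Data.Fin using (Fin; toℕ)
open import Data.Vec using (Vec; lookup; replicate)
open import Data.Product using (Σ; _×_)
open import Data.Sum using (_⊎_)
open import Relation.Binary.PropositionalEquality using (_≡_; _≢_)

fib : ℕ → ℕ
fib zero = zero
fib (suc zero) = suc zero
fib (suc (suc m)) = fib (suc m) + fib m

Peg : Set
Peg = Fin 3

-- A state with n disks: disk number (toℕ i + 1) sits on peg (lookup s i).
-- This is exactly an ordered triple (A,B,C) of disjoint sets with union Δ_n
-- (each peg's stack order is forced: decreasing, top = minimum).
State : ℕ → Set
State n = Vec Peg n

disk : {n : ℕ} → Fin n → ℕ
disk i = suc (toℕ i)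

-- A k-Fibonacci move from s to t: distinct pegs X, Y, Z with
-- disk k on top of X (all disks < k on Y, hence Z only has disks > k),
-- and t obtained by moving disks k-1 and k (only k when k = 1) onto Z,
-- all other disks staying in place.
FibMove : (n k : ℕ) → State n → State n → Set
FibMove n k s t =
  Σ Peg λ X → Σ Peg λ Y → Σ Peg λ Z →
    (X ≢ Y) × (X ≢ Z) × (Y ≢ Z) × (1 ≤ k) × (k ≤ n) ×
    (∀ i → disk i ≡ k → lookup s i ≡ X) ×
    (∀ i → disk i < k → lookup s i ≡ Y) ×
    (∀ i → (disk i ≡ k ⊎ suc (disk i) ≡ k) → lookup t i ≡ Z) ×
    (∀ i → disk i ≢ k → suc (disk i) ≢ k → lookup t i ≡ lookup s i)

data Path (n : ℕ) : State n → State n → Set where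
  []  : ∀ {s} → Path n s s
  step : ∀ {s u t} (k : ℕ) → FibMove n k s u → Path n u t → Path n s t

len : ∀ {n s t} → Path n s t → ℕ
len [] = zero
len (step k m p) = suc (len p)

countMoves : ∀ {n s t} → ℕ → Path n s t → ℕ
countMoves k [] = zero
countMoves k (step j m p) with k ≟ j
... | yes _ = suc (countMoves k p)
... | no _ = countMoves k p

start : (n : ℕ) → State n
start n = replicate n Data.Fin.zero

goal : (n : ℕ) → State n
goal n = replicate n (Data.Fin.suc (Data.Fin.suc Data.Fin.zero))

Solution : ℕ → Set
Solution n = Path n (start n) (goal n)

Optimal : ∀ {n} → Solution n → Set
Optimal {n} p = ∀ (q : Solution n) → len p ≤ len q

-- Let T j = optLength j be the length of an optimal transfer of the tower Δ_j.  The optimal transfer of Δ_(j+1)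
-- from a to b moves Δ_j to the third peg c, makes the (j+1)-move carrying j and j+1 onto b, and
-- moves Δ_(j-1) from c to b; hence T (j+1) = T j + 1 + T (j-1) and the number of k-moves obeys
-- the Fibonacci recursion in j.  Optimality and rigidity come from a potential on states
-- (a lower bound for the distance to "Δ_m gathered on b") that drops by at most one per move:
-- any transfer of length at most T (j+1) must split exactly like the canonical one, and then
-- its pieces are again optimal transfers of Δ_j and Δ_(j-1).
module Submission where

open import Defs
open import Data.Nat using (ℕ; zero; suc; pred; _+_; _∸_; _≤_; _<_; _≟_; _≤?_; _<?_; _⊓_; z≤n; s≤s)
open import Data.Nat.Properties
open import Data.Bool using (if_then_else_)
open import Data.Fin using (Fin; toℕ; fromℕ<) renaming (zero to fz; suc to fs)
open import Data.Fin.Properties using (all?; toℕ<n; fromℕ<-toℕ; toℕ-fromℕ<) renaming (_≟_ to _≟ₚ_)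
open import Data.Vec using (lookup; tabulate; replicate)
open import Data.Vec.Properties using (lookup∘tabulate; lookup-replicate)
open import Data.Vec.Relation.Binary.Pointwise.Extensional using (ext; Pointwise-≡⇒≡)
open import Data.Product using (Σ; _×_; _,_; proj₁; proj₂)
open import Data.Sum using (_⊎_; inj₁; inj₂; [_,_]′)
open import Data.Empty using (⊥-elim)
open import Data.Unit using (⊤; tt)
open import Relation.Nullary using (¬_; Dec; yes; no; does)
open import Relation.Nullary.Decidable using (from-yes; ¬?; _→-dec_; _⊎-dec_)
open import Relation.Unary using (Decidable)
open import Function using (_∘_)
open import Relation.Binary.PropositionalEquality

third : Peg → Peg → Peg
third fz           (fs fz)      = fs (fs fz)
third fz           (fs (fs fz)) = fs fz
third (fs fz)      fz           = fs (fs fz)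
third (fs fz)      (fs (fs fz)) = fz
third (fs (fs fz)) fz           = fs fz
third (fs (fs fz)) (fs fz)      = fz
third x            _            = x

third-≢ˡ : ∀ x y → x ≢ y → third x y ≢ x
third-≢ˡ = from-yes (all? λ x → all? λ y → ¬? (x ≟ₚ y) →-dec ¬? (third x y ≟ₚ x))

third-≢ʳ : ∀ x y → x ≢ y → third x y ≢ y
third-≢ʳ = from-yes (all? λ x → all? λ y → ¬? (x ≟ₚ y) →-dec ¬? (third x y ≟ₚ y))

third-unique : ∀ x y z → x ≢ y → z ≢ x → z ≢ y → z ≡ third x y
third-unique = from-yes (all? λ x → all? λ y → all? λ z →
  ¬? (x ≟ₚ y) →-dec ¬? (z ≟ₚ x) →-dec ¬? (z ≟ₚ y) →-dec z ≟ₚ third x y)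

-- States read by disk number

-- Disk 0 and disks above n do not exist; pegOf puts them on the first peg.
pegOf : ∀ {n} → State n → ℕ → Peg
pegOf v zero = fz
pegOf {n} v (suc d) with d <? n
... | yes d<n = lookup v (fromℕ< d<n)
... | no _ = fz

pegOf-disk : ∀ {n} (v : State n) (i : Fin n) → pegOf v (disk i) ≡ lookup v i
pegOf-disk {n} v i with toℕ i <? n
... | yes i<n = cong (lookup v) (fromℕ<-toℕ i i<n)
... | no i≮n = ⊥-elim (i≮n (toℕ<n i))

pegOf-beyond : ∀ {n} (v : State n) {d} → n < d → pegOf v d ≡ fz
pegOf-beyond {n} v {suc d} n<d with d <? n
... | yes d<n = ⊥-elim (<⇒≱ d<n (≤-pred n<d))
... | no _ = refl

diskIndex : ∀ {n d} → 1 ≤ d → d ≤ n → Σ (Fin n) λ i → disk i ≡ d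
diskIndex {d = suc d} _ d≤n = fromℕ< d≤n , cong suc (toℕ-fromℕ< d≤n)

state-ext : ∀ {n} {s t : State n} → (∀ d → 1 ≤ d → d ≤ n → pegOf s d ≡ pegOf t d) → s ≡ t
state-ext {s = s} {t} same = Pointwise-≡⇒≡ (ext λ i →
  trans (sym (pegOf-disk s i)) (trans (same (disk i) (s≤s z≤n) (toℕ<n i)) (pegOf-disk t i)))

place : ∀ {n} {P : ℕ → Set} → Decidable P → Peg → State n → State n
place P? a v = tabulate λ i → if does (P? (disk i)) then a else lookup v i

pegOf-place : ∀ {n} {P : ℕ → Set} (P? : Decidable P) a (v : State n) {d} → 1 ≤ d → d ≤ n → P d →
              pegOf (place P? a v) d ≡ a
pegOf-place P? a v 1≤d d≤n Pd with diskIndex 1≤d d≤n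
... | i , refl rewrite pegOf-disk (place P? a v) i
                     | lookup∘tabulate (λ i → if does (P? (disk i)) then a else lookup v i) i
                     with P? (disk i)
...   | yes _ = refl
...   | no ¬Pd = ⊥-elim (¬Pd Pd)

pegOf-unplaced : ∀ {n} {P : ℕ → Set} (P? : Decidable P) a (v : State n) {d} → ¬ P d →
                 pegOf (place P? a v) d ≡ pegOf v d
pegOf-unplaced P? a v {zero} ¬Pd = refl
pegOf-unplaced {n} P? a v {suc d} ¬Pd with n <? suc d
... | yes n<d = trans (pegOf-beyond _ n<d) (sym (pegOf-beyond v n<d))
... | no n≮d with diskIndex (s≤s z≤n) (≮⇒≥ n≮d)
...   | i , refl rewrite pegOf-disk (place P? a v) i | pegOf-disk v i
                       | lookup∘tabulate (λ i → if does (P? (disk i)) then a else lookup v i) i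
                       with P? (disk i)
...     | yes Pd = ⊥-elim (¬Pd Pd)
...     | no _ = refl

Gathered : ∀ {n} → ℕ → State n → Peg → Set
Gathered j v a = ∀ d → 1 ≤ d → d ≤ j → pegOf v d ≡ a

gathered-≤ : ∀ {n i j} {v : State n} {a} → i ≤ j → Gathered j v a → Gathered i v a
gathered-≤ i≤j g d 1≤d d≤i = g d 1≤d (≤-trans d≤i i≤j)

gathered-top : ∀ {n j} {v : State n} {a} → Gathered (suc j) v a → pegOf v (suc j) ≡ a
gathered-top g = g _ (s≤s z≤n) ≤-refl

replicate-gathered : ∀ n a → Gathered n (replicate n a) a
replicate-gathered n a d 1≤d d≤n with diskIndex 1≤d d≤n
... | i , refl = trans (pegOf-disk _ i) (lookup-replicate i a)

-- Optimal lengths and move counts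

+-tight : ∀ {a b c d} → a + b ≤ c + d → c ≤ a → d ≤ b → a ≤ c × b ≤ d
+-tight {a} {b} {c} {d} sum≤ c≤a d≤b =
  +-cancelʳ-≤ d a c (≤-trans (+-monoʳ-≤ a d≤b) sum≤) , +-cancelˡ-≤ c b d (≤-trans (+-monoˡ-≤ b c≤a) sum≤)

optLength : ℕ → ℕ
optLength zero = 0
optLength (suc zero) = 1
optLength (suc (suc j)) = suc (optLength j + optLength (suc j))

optLength-suc : ∀ j → optLength (suc j) ≡ suc (optLength (pred j) + optLength j)
optLength-suc zero = refl
optLength-suc (suc j) = refl

optLength-mono : ∀ j → optLength j ≤ optLength (suc j)
optLength-mono j rewrite optLength-suc j = m≤n⇒m≤1+n (m≤n+m (optLength j) _)

optLength-split : ∀ j → optLength j + suc (optLength (pred j)) ≡ optLength (suc j)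
optLength-split j = begin
  optLength j + suc (optLength (pred j)) ≡⟨ +-suc (optLength j) _ ⟩
  suc (optLength j + optLength (pred j)) ≡⟨ cong suc (+-comm (optLength j) _) ⟩
  suc (optLength (pred j) + optLength j) ≡⟨ optLength-suc j ⟨
  optLength (suc j)                      ∎
  where open ≡-Reasoning

δ : ℕ → ℕ → ℕ
δ k j with k ≟ j
... | yes _ = 1
... | no _ = 0

optCount : ℕ → ℕ → ℕ
optCount zero k = 0
optCount (suc zero) k = δ k 1
optCount (suc (suc j)) k = optCount (suc j) k + (δ k (suc (suc j)) + optCount j k)

optCount-split : ∀ j k → optCount j k + (δ k (suc j) + optCount (pred j) k) ≡ optCount (suc j) k
optCount-split zero k = +-identityʳ (δ k 1)
optCount-split (suc j) k = refl

δ-≢ : ∀ {k j} → k ≢ j → δ k j ≡ 0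
δ-≢ {k} {j} k≢j with k ≟ j
... | yes k≡j = ⊥-elim (k≢j k≡j)
... | no _ = refl

suc-∸ : ∀ {m k} → k ≤ m → suc m ∸ k ≡ suc (m ∸ k)
suc-∸ = +-∸-assoc 1

fib-∸ : ∀ {m k} → m ≤ k → fib (m ∸ k) ≡ 0
fib-∸ m≤k rewrite m≤n⇒m∸n≡0 m≤k = refl

fib-∸-recurrence : ∀ {m k} → k ≤ m → fib (suc (suc m) ∸ k) ≡ fib (suc m ∸ k) + fib (m ∸ k)
fib-∸-recurrence k≤m rewrite suc-∸ (m≤n⇒m≤1+n k≤m) | suc-∸ k≤m = refl

δ-fib : ∀ {m k} → m ≤ k → δ k m ≡ fib (suc m ∸ k)
δ-fib {m} {k} m≤k with m≤n⇒m<n∨m≡n m≤k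
... | inj₁ m<k = trans (δ-≢ (λ k≡m → <⇒≢ m<k (sym k≡m))) (sym (fib-∸ m<k))
... | inj₂ refl with k ≟ k
...   | no k≢k = ⊥-elim (k≢k refl)
...   | yes _ rewrite suc-∸ (≤-refl {k}) | n∸n≡0 k = refl

fib-∸-step : ∀ m k → fib (suc m ∸ k) + (δ k (suc m) + fib (m ∸ k)) ≡ fib (suc (suc m) ∸ k)
fib-∸-step m k with k ≤? m
... | yes k≤m = begin
  fib (suc m ∸ k) + (δ k (suc m) + fib (m ∸ k))
    ≡⟨ cong (λ x → fib (suc m ∸ k) + (x + fib (m ∸ k))) (δ-≢ (<⇒≢ (s≤s k≤m))) ⟩
  fib (suc m ∸ k) + fib (m ∸ k)
    ≡⟨ fib-∸-recurrence k≤m ⟨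
  fib (suc (suc m) ∸ k) ∎
  where open ≡-Reasoning
... | no k≰m = begin
  fib (suc m ∸ k) + (δ k (suc m) + fib (m ∸ k))
    ≡⟨ cong₂ (λ x y → x + (δ k (suc m) + y)) (fib-∸ m<k) (fib-∸ (<⇒≤ m<k)) ⟩
  δ k (suc m) + 0
    ≡⟨ +-identityʳ _ ⟩
  δ k (suc m)
    ≡⟨ δ-fib m<k ⟩
  fib (suc (suc m) ∸ k) ∎
  where
  open ≡-Reasoning
  m<k : m < k
  m<k = ≰⇒> k≰m

optCount-fib : ∀ j k → 1 ≤ k → optCount j k ≡ fib (suc j ∸ k)
optCount-fib zero k 1≤k = sym (fib-∸ 1≤k)
optCount-fib (suc zero) k 1≤k = δ-fib 1≤k
optCount-fib (suc (suc j)) k 1≤k = begin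
  optCount (suc j) k + (δ k (suc (suc j)) + optCount j k)
    ≡⟨ cong₂ (λ x y → x + (δ k (suc (suc j)) + y)) (optCount-fib (suc j) k 1≤k) (optCount-fib j k 1≤k) ⟩
  fib (suc (suc j) ∸ k) + (δ k (suc (suc j)) + fib (suc j ∸ k))
    ≡⟨ fib-∸-step (suc j) k ⟩
  fib (suc (suc (suc j)) ∸ k) ∎
  where open ≡-Reasoning

-- A potential bounding the distance to a gathered tower

-- The second clause: disk m+1, lying on p ≠ b, still has to make a move, before which disks 1..m
-- must be gathered on one of the other two pegs, and after which disks 1..m-1 still face a transfer.
stage : ℕ → Peg → Peg → (Peg → ℕ) → ℕ
stage m p b f with p ≟ₚ b
... | yes _ = f b
... | no _ = suc (optLength (pred m) + (f (third p b) ⊓ f b))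

potential : ∀ {n} → ℕ → State n → Peg → ℕ
potential zero v b = 0
potential (suc m) v b = stage m (pegOf v (suc m)) b (potential m v)

stage-≡ : ∀ m {p b} f → p ≡ b → stage m p b f ≡ f b
stage-≡ m {p} {b} f p≡b with p ≟ₚ b
... | yes _ = refl
... | no p≢b = ⊥-elim (p≢b p≡b)

stage-≢ : ∀ m {p b} f → p ≢ b → stage m p b f ≡ suc (optLength (pred m) + (f (third p b) ⊓ f b))
stage-≢ m {p} {b} f p≢b with p ≟ₚ b
... | yes p≡b = ⊥-elim (p≢b p≡b)
... | no _ = refl

stage-mono : ∀ m p b {f g} → (∀ x → f x ≤ suc (g x)) → stage m p b f ≤ suc (stage m p b g)
stage-mono m p b f≤g with p ≟ₚ b
... | yes _ = f≤g b
... | no _ = s≤s (≤-trans (+-monoʳ-≤ (optLength (pred m)) (⊓-mono-≤ (f≤g (third p b)) (f≤g b)))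
                          (≤-reflexive (+-suc (optLength (pred m)) _)))

potential-top-home : ∀ {n} i (v : State n) {x} → pegOf v (suc i) ≡ x → potential (suc i) v x ≡ potential i v x
potential-top-home i v = stage-≡ i (potential i v)

potential-top-away : ∀ {n} i (v : State n) {x} → pegOf v (suc i) ≢ x → suc (optLength (pred i)) ≤ potential (suc i) v x
potential-top-away i v top≢x rewrite stage-≢ i (potential i v) top≢x = s≤s (m≤m+n _ _)

potential-≤1 : ∀ {n} (v : State n) b → potential 1 v b ≤ 1
potential-≤1 v b = stage-≤1 (pegOf v 1)
  where
  stage-≤1 : ∀ p → stage 0 p b (λ _ → 0) ≤ 1
  stage-≤1 p with p ≟ₚ b
  ... | yes _ = z≤n
  ... | no _ = ≤-refl

potential-gathered : ∀ {n} i (v : State n) {b} → Gathered i v b → potential i v b ≡ 0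
potential-gathered zero v g = refl
potential-gathered (suc i) v g =
  trans (potential-top-home i v (gathered-top g)) (potential-gathered i v (gathered-≤ (n≤1+n i) g))

potential-away : ∀ {n} i (v : State n) {a b} → Gathered i v a → a ≢ b → potential i v b ≡ optLength i
potential-away zero v g a≢b = refl
potential-away (suc i) v {a} {b} g a≢b = begin
  potential (suc i) v b
    ≡⟨ stage-≢ i (potential i v) (λ top≡b → a≢b (trans (sym (gathered-top g)) top≡b)) ⟩
  suc (optLength (pred i) + (potential i v (third top b) ⊓ potential i v b))
    ≡⟨ cong (λ x → suc (optLength (pred i) + (potential i v (third x b) ⊓ potential i v b))) (gathered-top g) ⟩
  suc (optLength (pred i) + (potential i v (third a b) ⊓ potential i v b))
    ≡⟨ cong₂ (λ x y → suc (optLength (pred i) + (x ⊓ y)))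
             (potential-away i v g' (λ a≡c → third-≢ˡ a b a≢b (sym a≡c))) (potential-away i v g' a≢b) ⟩
  suc (optLength (pred i) + (optLength i ⊓ optLength i))
    ≡⟨ cong (λ x → suc (optLength (pred i) + x)) (⊓-idem (optLength i)) ⟩
  suc (optLength (pred i) + optLength i)
    ≡⟨ optLength-suc i ⟨
  optLength (suc i) ∎
  where
  open ≡-Reasoning
  top : Peg
  top = pegOf v (suc i)
  g' : Gathered i v a
  g' = gathered-≤ (n≤1+n i) g

potential-two-away : ∀ {n} i (v : State n) {x Z} → pegOf v (suc i) ≡ Z → (1 ≤ i → pegOf v i ≡ Z) → Z ≢ x →
                     suc (optLength i) ≤ potential (suc i) v x
potential-two-away zero v top≡Z _ Z≢x = potential-top-away 0 v (λ top≡x → Z≢x (trans (sym top≡Z) top≡x))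
potential-two-away (suc i) v {x} {Z} top≡Z second≡Z Z≢x = begin
  suc (optLength (suc i))
    ≡⟨ cong suc (optLength-split i) ⟨
  suc (optLength i + suc (optLength (pred i)))
    ≤⟨ s≤s (+-monoʳ-≤ (optLength i) (⊓-glb (potential-top-away i v second≢third) (potential-top-away i v second≢x))) ⟩
  suc (optLength i + (potential (suc i) v (third Z x) ⊓ potential (suc i) v x))
    ≡⟨ cong (λ p → suc (optLength i + (potential (suc i) v (third p x) ⊓ potential (suc i) v x))) top≡Z ⟨
  suc (optLength i + (potential (suc i) v (third (pegOf v (suc (suc i))) x) ⊓ potential (suc i) v x))
    ≡⟨ stage-≢ (suc i) (potential (suc i) v) (λ top≡x → Z≢x (trans (sym top≡Z) top≡x)) ⟨
  potential (suc (suc i)) v x ∎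
  where
  open ≤-Reasoning
  second : pegOf v (suc i) ≡ Z
  second = second≡Z (s≤s z≤n)
  second≢third : pegOf v (suc i) ≢ third Z x
  second≢third e = third-≢ˡ Z x Z≢x (trans (sym e) second)
  second≢x : pegOf v (suc i) ≢ x
  second≢x e = Z≢x (trans (sym second) e)

Moved : ℕ → ℕ → Set
Moved k d = d ≡ k ⊎ suc d ≡ k

moved? : ∀ k → Decidable (Moved k)
moved? k d = d ≟ k ⊎-dec suc d ≟ k

moved-≤ : ∀ {k d} → Moved k d → d ≤ k
moved-≤ (inj₁ refl) = ≤-refl
moved-≤ (inj₂ refl) = n≤1+n _

below-unmoved : ∀ {k d} → suc d < k → ¬ Moved k d
below-unmoved {d = d} sd<k (inj₁ d≡k) = <⇒≢ (<-trans (n<1+n d) sd<k) d≡k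
below-unmoved sd<k (inj₂ sd≡k) = <⇒≢ sd<k sd≡k

above-unmoved : ∀ {k d} → k < d → ¬ Moved k d
above-unmoved k<d (inj₁ d≡k) = <⇒≢ k<d (sym d≡k)
above-unmoved k<d (inj₂ sd≡k) = <⇒≢ (m<n⇒m<1+n k<d) (sym sd≡k)

unmoved-above : ∀ {k d} → pred (pred k) < d → ¬ Moved k d → k < d
unmoved-above {zero} 0<d _ = 0<d
unmoved-above {suc zero} 0<d unmoved = ≤∧≢⇒< 0<d (λ 1≡d → unmoved (inj₁ (sym 1≡d)))
unmoved-above {suc (suc k)} k<d unmoved =
  ≤∧≢⇒< (≤∧≢⇒< k<d (λ 1+k≡d → unmoved (inj₂ (cong suc (sym 1+k≡d)))))
        (λ 2+k≡d → unmoved (inj₁ (sym 2+k≡d)))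

≤-pred-< : ∀ {d j} → 1 ≤ d → d ≤ pred j → d < j
≤-pred-< {j = zero} 1≤d d≤0 = ⊥-elim (<⇒≱ 1≤d d≤0)
≤-pred-< {j = suc j} _ d≤j = s≤s d≤j

module Hanoi (n : ℕ) where

  record Move (k : ℕ) (s t : State n) : Set where
    field
      X Y Z : Peg
      X≢Y : X ≢ Y
      X≢Z : X ≢ Z
      Y≢Z : Y ≢ Z
      1≤k : 1 ≤ k
      k≤n : k ≤ n
      source : pegOf s k ≡ X
      smaller : ∀ d → 1 ≤ d → d < k → pegOf s d ≡ Y
      target : ∀ d → 1 ≤ d → Moved k d → pegOf t d ≡ Z
      fixed : ∀ d → ¬ Moved k d → pegOf t d ≡ pegOf s d

    target-top : pegOf t k ≡ Z
    target-top = target k 1≤k (inj₁ refl)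

    untouched-above : ∀ {d} → k < d → pegOf t d ≡ pegOf s d
    untouched-above k<d = fixed _ (above-unmoved k<d)

  toMove : ∀ {k s t} → FibMove n k s t → Move k s t
  toMove {k} {s} {t} (X , Y , Z , X≢Y , X≢Z , Y≢Z , 1≤k , k≤n , onX , onY , onZ , same) = record
    { X = X ; Y = Y ; Z = Z ; X≢Y = X≢Y ; X≢Z = X≢Z ; Y≢Z = Y≢Z ; 1≤k = 1≤k ; k≤n = k≤n
    ; source = source ; smaller = smaller ; target = target ; fixed = fixed }
    where
    source : pegOf s k ≡ X
    source with diskIndex 1≤k k≤n
    ... | i , i≡k = trans (cong (pegOf s) (sym i≡k)) (trans (pegOf-disk s i) (onX i i≡k))
    smaller : ∀ d → 1 ≤ d → d < k → pegOf s d ≡ Y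
    smaller d 1≤d d<k with diskIndex 1≤d (≤-trans (<⇒≤ d<k) k≤n)
    ... | i , refl = trans (pegOf-disk s i) (onY i d<k)
    target : ∀ d → 1 ≤ d → Moved k d → pegOf t d ≡ Z
    target d 1≤d moved with diskIndex 1≤d (≤-trans (moved-≤ moved) k≤n)
    ... | i , refl = trans (pegOf-disk t i) (onZ i moved)
    fixed : ∀ d → ¬ Moved k d → pegOf t d ≡ pegOf s d
    fixed zero _ = refl
    fixed (suc d) unmoved with n <? suc d
    ... | yes n<d = trans (pegOf-beyond t n<d) (sym (pegOf-beyond s n<d))
    ... | no n≮d with diskIndex (s≤s z≤n) (≮⇒≥ n≮d)
    ...   | i , refl = trans (pegOf-disk t i) (trans (same i (unmoved ∘ inj₁) (unmoved ∘ inj₂)) (sym (pegOf-disk s i)))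

  fromMove : ∀ {k s t} → Move k s t → FibMove n k s t
  fromMove {k} {s} {t} mv = X , Y , Z , X≢Y , X≢Z , Y≢Z , 1≤k , k≤n ,
    (λ i i≡k → trans (sym (pegOf-disk s i)) (subst (λ d → pegOf s d ≡ X) (sym i≡k) source)) ,
    (λ i i<k → trans (sym (pegOf-disk s i)) (smaller _ (s≤s z≤n) i<k)) ,
    (λ i moved → trans (sym (pegOf-disk t i)) (target _ (s≤s z≤n) moved)) ,
    (λ i i≢k si≢k → trans (sym (pegOf-disk t i)) (trans (fixed _ [ i≢k , si≢k ]′) (pegOf-disk s i)))
    where open Move mv

  smaller-gathered : ∀ {j s t} (mv : Move (suc j) s t) → Gathered j s (Move.Y mv)
  smaller-gathered mv d 1≤d d≤j = Move.smaller mv d 1≤d (s≤s d≤j)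

  remaining-gathered : ∀ {j s t} (mv : Move (suc j) s t) → Gathered (pred j) t (Move.Y mv)
  remaining-gathered mv d 1≤d d≤j-1 =
    trans (Move.fixed mv d (below-unmoved (s≤s d<j))) (Move.smaller mv d 1≤d (m<n⇒m<1+n d<j))
    where
    d<j : d < _
    d<j = ≤-pred-< 1≤d d≤j-1

  after-move-agrees : ∀ {k u w} {t : State n} (mv : Move k u w) → Gathered k t (Move.Z mv) →
                      (∀ d → k < d → pegOf u d ≡ pegOf t d) → ∀ d → pred (pred k) < d → pegOf w d ≡ pegOf t d
  after-move-agrees {k} mv gt agree d k-2<d with moved? k d
  ... | yes moved = trans (Move.target mv d 1≤d moved) (sym (gt d 1≤d (moved-≤ moved)))
    where
    1≤d : 1 ≤ d
    1≤d = ≤-trans (s≤s z≤n) k-2<d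
  ... | no unmoved = trans (Move.fixed mv d unmoved) (agree d (unmoved-above k-2<d unmoved))

  legal-move : ∀ {k u X Y Z} → X ≢ Y → X ≢ Z → Y ≢ Z → 1 ≤ k → k ≤ n → pegOf u k ≡ X →
               (∀ d → 1 ≤ d → d < k → pegOf u d ≡ Y) → Move k u (place (moved? k) Z u)
  legal-move {k} {u} {X} {Y} {Z} X≢Y X≢Z Y≢Z 1≤k k≤n source smaller = record
    { X = X ; Y = Y ; Z = Z ; X≢Y = X≢Y ; X≢Z = X≢Z ; Y≢Z = Y≢Z ; 1≤k = 1≤k ; k≤n = k≤n
    ; source = source ; smaller = smaller
    ; target = λ d 1≤d moved → pegOf-place (moved? k) Z u 1≤d (≤-trans (moved-≤ moved) k≤n) moved
    ; fixed = λ d unmoved → pegOf-unplaced (moved? k) Z u unmoved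
    }

  _++ₚ_ : ∀ {s u t} → Path n s u → Path n u t → Path n s t
  [] ++ₚ q = q
  step k m p ++ₚ q = step k m (p ++ₚ q)

  len-++ : ∀ {s u t} (p : Path n s u) (q : Path n u t) → len (p ++ₚ q) ≡ len p + len q
  len-++ [] q = refl
  len-++ (step k m p) q = cong suc (len-++ p q)

  -- FibMove is a Σ-type, so the endpoints of a step cannot be inferred from the move and are given explicitly.
  countMoves-step : ∀ κ {s u t} k (m : FibMove n k s u) (p : Path n u t) →
                    countMoves κ (step {s = s} {u = u} k m p) ≡ δ κ k + countMoves κ p
  countMoves-step κ k m p with κ ≟ k
  ... | yes _ = refl
  ... | no _ = refl

  countMoves-++ : ∀ κ {s u t} (p : Path n s u) (q : Path n u t) →
                  countMoves κ (p ++ₚ q) ≡ countMoves κ p + countMoves κ q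
  countMoves-++ κ [] q = refl
  countMoves-++ κ (step {s} {u} k m p) q = begin
    countMoves κ (step {s = s} {u = u} k m (p ++ₚ q)) ≡⟨ countMoves-step κ {s} {u} k m (p ++ₚ q) ⟩
    δ κ k + countMoves κ (p ++ₚ q)                    ≡⟨ cong (δ κ k +_) (countMoves-++ κ p q) ⟩
    δ κ k + (countMoves κ p + countMoves κ q)         ≡⟨ +-assoc (δ κ k) _ _ ⟨
    δ κ k + countMoves κ p + countMoves κ q           ≡⟨ cong (_+ countMoves κ q) (countMoves-step κ {s} {u} k m p) ⟨
    countMoves κ (step {s = s} {u = u} k m p) + countMoves κ q ∎
    where open ≡-Reasoning

  countMoves≤len : ∀ κ {s t} (p : Path n s t) → countMoves κ p ≤ len p
  countMoves≤len κ [] = z≤n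
  countMoves≤len κ (step k m p) with κ ≟ k
  ... | yes _ = s≤s (countMoves≤len κ p)
  ... | no _ = m≤n⇒m≤1+n (countMoves≤len κ p)

  MovesAtMost : ∀ {s t} → ℕ → Path n s t → Set
  MovesAtMost j [] = ⊤
  MovesAtMost j (step k m p) = k ≤ j × MovesAtMost j p

  movesAtMost-n : ∀ {s t} (p : Path n s t) → MovesAtMost n p
  movesAtMost-n [] = tt
  movesAtMost-n (step {s} {u} k m p) = Move.k≤n (toMove {k} {s} {u} m) , movesAtMost-n p

  movesAtMost-++ : ∀ {j s u t} (p : Path n s u) (q : Path n u t) → MovesAtMost j (p ++ₚ q) → MovesAtMost j p × MovesAtMost j q
  movesAtMost-++ [] q low = tt , low
  movesAtMost-++ (step k m p) q (k≤j , low) = (k≤j , proj₁ (movesAtMost-++ p q low)) , proj₂ (movesAtMost-++ p q low)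

  pegOf-unmoved : ∀ {j d s t} (p : Path n s t) → MovesAtMost j p → j < d → pegOf t d ≡ pegOf s d
  pegOf-unmoved [] _ _ = refl
  pegOf-unmoved (step {s} {u} k m p) (k≤j , low) j<d =
    trans (pegOf-unmoved p low j<d) (Move.untouched-above (toMove {k} {s} {u} m) (≤-<-trans k≤j j<d))

  data Decomposition (j : ℕ) {s t : State n} : Path n s t → Set where
    decomposition : ∀ {u w} (p₁ : Path n s u) → MovesAtMost j p₁ →
                    ∀ k → j < k → (m : FibMove n k u w) (p₂ : Path n w t) →
                    Decomposition j (p₁ ++ₚ step {s = u} {u = w} k m p₂)

  firstMoveAbove : ∀ j {s t} (p : Path n s t) → MovesAtMost j p ⊎ Decomposition j p
  firstMoveAbove j [] = inj₁ tt
  firstMoveAbove j (step k m p) with k ≤? j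
  ... | no k≰j = inj₂ (decomposition [] tt k (≰⇒> k≰j) m p)
  ... | yes k≤j with firstMoveAbove j p
  ...   | inj₁ low = inj₁ (k≤j , low)
  ...   | inj₂ (decomposition p₁ low k' j<k' m' p₂) = inj₂ (decomposition (step k m p₁) (k≤j , low) k' j<k' m' p₂)

  transfer-decomposes : ∀ j {s t} (p : Path n s t) {a b} → a ≢ b → Gathered (suc j) s a → Gathered (suc j) t b →
                        Decomposition j p
  transfer-decomposes j p a≢b gs gt with firstMoveAbove j p
  ... | inj₂ dec = dec
  ... | inj₁ low = ⊥-elim (a≢b (trans (sym (gathered-top gs)) (trans (sym (pegOf-unmoved p low ≤-refl)) (gathered-top gt))))

  potential-after-move-away : ∀ {i s t} (mv : Move (suc i) s t) {x} → Move.Z mv ≢ x → suc (optLength i) ≤ potential (suc i) t x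
  potential-after-move-away {i} {t = t} mv = potential-two-away i t target-top (λ 1≤i → target i 1≤i (inj₂ refl))
    where open Move mv

  potential-after-move-home : ∀ {i s t} (mv : Move (suc (suc i)) s t) {b} → Move.Z mv ≡ b →
                              potential (suc (suc i)) t b ≡ optLength i
  potential-after-move-home {i} {t = t} mv {b} Z≡b = begin
    potential (suc (suc i)) t b ≡⟨ potential-top-home (suc i) t (trans target-top Z≡b) ⟩
    potential (suc i) t b       ≡⟨ potential-top-home i t (trans (target (suc i) (s≤s z≤n) (inj₂ refl)) Z≡b) ⟩
    potential i t b             ≡⟨ potential-away i t (remaining-gathered mv) (λ Y≡b → Y≢Z (trans Y≡b (sym Z≡b))) ⟩
    optLength i                 ∎
    where
    open Move mv
    open ≡-Reasoning

  potential-after-move : ∀ {i s t} (mv : Move (suc (suc i)) s t) b → optLength i ≤ potential (suc (suc i)) t b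
  potential-after-move {i} {t = t} mv b with Move.Z mv ≟ₚ b
  ... | yes Z≡b = ≤-reflexive (sym (potential-after-move-home mv Z≡b))
  ... | no Z≢b = <⇒≤ (potential-top-away (suc i) t (λ top≡b → Z≢b (trans (sym (Move.target-top mv)) top≡b)))

  potential-before-move : ∀ {i s t} (mv : Move (suc (suc i)) s t) {b} → Move.X mv ≢ b →
                          potential (suc (suc i)) s b ≤ suc (optLength i)
  potential-before-move {i} {s} mv {b} X≢b = begin
    potential (suc (suc i)) s b
      ≡⟨ stage-≢ (suc i) (potential (suc i) s) (λ top≡b → X≢b (trans (sym source) top≡b)) ⟩
    suc (optLength i + (potential (suc i) s (third (pegOf s (suc (suc i))) b) ⊓ potential (suc i) s b))
      ≡⟨ cong (λ x → suc (optLength i + (potential (suc i) s (third x b) ⊓ potential (suc i) s b))) source ⟩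
    suc (optLength i + (potential (suc i) s (third X b) ⊓ potential (suc i) s b))
      ≤⟨ s≤s (+-monoʳ-≤ (optLength i) min≤0) ⟩
    suc (optLength i + 0)
      ≡⟨ cong suc (+-identityʳ _) ⟩
    suc (optLength i) ∎
    where
    open Move mv
    open ≤-Reasoning
    Y-free : potential (suc i) s Y ≡ 0
    Y-free = potential-gathered (suc i) s (smaller-gathered mv)
    min≤0 : potential (suc i) s (third X b) ⊓ potential (suc i) s b ≤ 0
    min≤0 with Y ≟ₚ b
    ... | yes Y≡b = ≤-trans (m⊓n≤n _ _) (≤-reflexive (trans (cong (potential (suc i) s) (sym Y≡b)) Y-free))
    ... | no Y≢b = ≤-trans (m⊓n≤m _ _) (≤-reflexive (trans (cong (potential (suc i) s) third≡Y) Y-free))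
      where
      third≡Y : third X b ≡ Y
      third≡Y = sym (third-unique X b Y X≢b (X≢Y ∘ sym) Y≢b)

  potential-step-top : ∀ m {s t} → Move (suc m) s t → ∀ b → potential (suc m) s b ≤ suc (potential (suc m) t b)
  potential-step-top zero {s} mv b = ≤-trans (potential-≤1 s b) (s≤s z≤n)
  potential-step-top (suc i) {s} {t} mv b with Move.X mv ≟ₚ b
  ... | no X≢b = ≤-trans (potential-before-move mv X≢b) (s≤s (potential-after-move mv b))
  ... | yes X≡b = m<n⇒m≤1+n (begin-strict
    potential (suc (suc i)) s b ≡⟨ potential-top-home (suc i) s (trans source X≡b) ⟩
    potential (suc i) s b       ≡⟨ potential-away (suc i) s (smaller-gathered mv) (λ Y≡b → X≢Y (trans X≡b (sym Y≡b))) ⟩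
    optLength (suc i)           <⟨ potential-after-move-away mv (λ Z≡b → X≢Z (trans X≡b (sym Z≡b))) ⟩
    potential (suc (suc i)) t b ∎)
    where
    open Move mv
    open ≤-Reasoning

  potential-step : ∀ m {k s t} → Move k s t → k ≤ m → ∀ b → potential m s b ≤ suc (potential m t b)
  potential-step zero mv k≤0 b = ⊥-elim (<⇒≱ (Move.1≤k mv) k≤0)
  potential-step (suc m) {k} {s} {t} mv k≤ b with m≤n⇒m<n∨m≡n k≤
  ... | inj₂ refl = potential-step-top m mv b
  ... | inj₁ k<sm rewrite Move.untouched-above mv k<sm =
    stage-mono m (pegOf s (suc m)) b (λ x → potential-step m mv (≤-pred k<sm) x)

  potential≤len : ∀ m {s t} (p : Path n s t) → MovesAtMost m p → ∀ {b} → Gathered m t b → potential m s b ≤ len p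
  potential≤len m {t = t} [] _ g = ≤-reflexive (potential-gathered m t g)
  potential≤len m (step {s} {u} k mv p) (k≤m , low) g =
    ≤-trans (potential-step m (toMove {k} {s} {u} mv) k≤m _) (s≤s (potential≤len m p low g))

  transfer-lowerBound : ∀ j {s t} (p : Path n s t) → MovesAtMost j p →
                        ∀ {a b} → a ≢ b → Gathered j s a → Gathered j t b → optLength j ≤ len p
  transfer-lowerBound j {s} p low a≢b gs gt = subst (_≤ len p) (potential-away j s gs a≢b) (potential≤len j p low gt)

  len-split : ∀ {s u w t} (p₁ : Path n s u) k (m : FibMove n k u w) (p₂ : Path n w t) →
              len (p₁ ++ₚ step {s = u} {u = w} k m p₂) ≡ len p₁ + suc (len p₂)
  len-split p₁ k m p₂ = len-++ p₁ (step k m p₂)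

  countMoves-split : ∀ κ {s u w t} (p₁ : Path n s u) k (m : FibMove n k u w) (p₂ : Path n w t) →
                     countMoves κ (p₁ ++ₚ step {s = u} {u = w} k m p₂) ≡ countMoves κ p₁ + (δ κ k + countMoves κ p₂)
  countMoves-split κ {u = u} {w} p₁ k m p₂ =
    trans (countMoves-++ κ p₁ (step k m p₂)) (cong (countMoves κ p₁ +_) (countMoves-step κ {u} {w} k m p₂))

  -- The canonical transfer

  record Transfer (j : ℕ) (s t : State n) : Set where
    field
      path : Path n s t
      path-length : len path ≡ optLength j
      path-counts : ∀ κ → countMoves κ path ≡ optCount j κ

  Transferable : ℕ → Set
  Transferable j = ∀ {s t} → j ≤ n → ∀ {a b} → a ≢ b → Gathered j s a → Gathered j t b →
                   (∀ d → j < d → pegOf s d ≡ pegOf t d) → Transfer j s t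

  transfer-step : ∀ j → Transferable (pred j) → Transferable j → Transferable (suc j)
  transfer-step j transfer₀ transfer₁ {s} {t} 1+j≤n {a} {b} a≢b gs gt agree = record
    { path = path P₁ ++ₚ step {s = u} {u = w} (suc j) (fromMove mv) (path P₂)
    ; path-length = begin
        len (path P₁ ++ₚ step (suc j) (fromMove mv) (path P₂))
          ≡⟨ len-split (path P₁) (suc j) (fromMove mv) (path P₂) ⟩
        len (path P₁) + suc (len (path P₂))
          ≡⟨ cong₂ (λ x y → x + suc y) (path-length P₁) (path-length P₂) ⟩
        optLength j + suc (optLength (pred j))
          ≡⟨ optLength-split j ⟩
        optLength (suc j) ∎
    ; path-counts = λ κ → begin
        countMoves κ (path P₁ ++ₚ step (suc j) (fromMove mv) (path P₂))
          ≡⟨ countMoves-split κ (path P₁) (suc j) (fromMove mv) (path P₂) ⟩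
        countMoves κ (path P₁) + (δ κ (suc j) + countMoves κ (path P₂))
          ≡⟨ cong₂ (λ x y → x + (δ κ (suc j) + y)) (path-counts P₁ κ) (path-counts P₂ κ) ⟩
        optCount j κ + (δ κ (suc j) + optCount (pred j) κ)
          ≡⟨ optCount-split j κ ⟩
        optCount (suc j) κ ∎
    }
    where
    open Transfer
    open ≡-Reasoning
    c : Peg
    c = third a b
    j≤n : j ≤ n
    j≤n = ≤-trans (n≤1+n j) 1+j≤n
    u : State n
    u = place (_≤? j) c s
    u-agree : ∀ d → j < d → pegOf u d ≡ pegOf s d
    u-agree d j<d = pegOf-unplaced (_≤? j) c s (<⇒≱ j<d)
    w : State n
    w = place (moved? (suc j)) b u
    mv : Move (suc j) u w
    mv = legal-move (third-≢ˡ a b a≢b ∘ sym) a≢b (third-≢ʳ a b a≢b) (s≤s z≤n) 1+j≤n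
           (trans (u-agree (suc j) ≤-refl) (gathered-top gs))
           (λ d 1≤d d≤j → pegOf-place (_≤? j) c s 1≤d (≤-trans (≤-pred d≤j) j≤n) (≤-pred d≤j))
    P₁ : Transfer j s u
    P₁ = transfer₁ j≤n (third-≢ˡ a b a≢b ∘ sym) (gathered-≤ (n≤1+n j) gs)
           (λ d 1≤d d≤j → pegOf-place (_≤? j) c s 1≤d (≤-trans d≤j j≤n) d≤j) (λ d j<d → sym (u-agree d j<d))
    P₂ : Transfer (pred j) w t
    P₂ = transfer₀ (≤-trans pred[n]≤n j≤n) (third-≢ʳ a b a≢b) (remaining-gathered mv)
           (gathered-≤ (≤-trans pred[n]≤n (n≤1+n j)) gt)
           (after-move-agrees mv gt (λ d 1+j<d → trans (u-agree d (<-trans (n<1+n j) 1+j<d)) (agree d 1+j<d)))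

  transfer : ∀ j → Transferable j
  transfer zero _ _ _ _ agree with state-ext (λ d 1≤d _ → agree d 1≤d)
  ... | refl = record { path = [] ; path-length = refl ; path-counts = λ _ → refl }
  transfer (suc zero) = transfer-step 0 (transfer 0) (transfer 0)
  transfer (suc (suc j)) = transfer-step (suc j) (transfer j) (transfer (suc j))

  -- Rigidity of short transfers

  countMoves-empty : ∀ κ {s t} (p : Path n s t) → len p ≤ 0 → countMoves κ p ≡ 0
  countMoves-empty κ p short = n≤0⇒n≡0 (≤-trans (countMoves≤len κ p) short)

  settled-below : ∀ i {w t} (q : Path n w t) → MovesAtMost (suc (suc i)) q → ∀ {b} →
                  pegOf w (suc i) ≡ b → pegOf w (suc (suc i)) ≡ b → Gathered (suc (suc i)) t b →
                  len q ≤ optLength i → MovesAtMost i q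
  settled-below i q low {b} w-second w-top gt short with firstMoveAbove i q
  ... | inj₁ low′ = low′
  ... | inj₂ (decomposition {u} {w′} q₁ low₁ k i<k m q₂) with movesAtMost-++ q₁ (step k m q₂) low
  ...   | _ , k≤2+i , low₂ with m≤n⇒m<n∨m≡n k≤2+i
  ...     | inj₂ refl = ⊥-elim (X≢Y (trans (sym source) (trans u-top (trans (sym u-second) u-second≡Y))))
    where
    open Move (toMove {suc (suc i)} {u} {w′} m)
    u-top : pegOf u (suc (suc i)) ≡ b
    u-top = trans (pegOf-unmoved q₁ low₁ (m<n⇒m<1+n ≤-refl)) w-top
    u-second : pegOf u (suc i) ≡ b
    u-second = trans (pegOf-unmoved q₁ low₁ ≤-refl) w-second
    u-second≡Y : pegOf u (suc i) ≡ Y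
    u-second≡Y = smaller (suc i) (s≤s z≤n) ≤-refl
  ...     | inj₁ k<2+i with ≤-antisym (≤-pred k<2+i) i<k
  ...       | refl = ⊥-elim (<-irrefl refl (begin-strict
    optLength i                     <⟨ n<1+n _ ⟩
    suc (optLength i)               ≤⟨ potential-after-move-away mv Z≢b ⟩
    potential (suc i) w′ b          ≡⟨ potential-top-home (suc i) w′ w′-top ⟨
    potential (suc (suc i)) w′ b    ≤⟨ potential≤len (suc (suc i)) q₂ low₂ gt ⟩
    len q₂                          ≤⟨ m≤n+m (len q₂) (suc (len q₁)) ⟩
    suc (len q₁ + len q₂)           ≡⟨ +-suc (len q₁) (len q₂) ⟨
    len q₁ + suc (len q₂)           ≡⟨ len-split q₁ (suc i) m q₂ ⟨
    len (q₁ ++ₚ step (suc i) m q₂)  ≤⟨ short ⟩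
    optLength i                     ∎))
    where
    open ≤-Reasoning
    mv : Move (suc i) u w′
    mv = toMove {suc i} {u} {w′} m
    open Move mv
    Z≢b : Z ≢ b
    Z≢b Z≡b = X≢Z (trans (sym source) (trans (pegOf-unmoved q₁ low₁ ≤-refl) (trans w-second (sym Z≡b))))
    w′-top : pegOf w′ (suc (suc i)) ≡ b
    w′-top = trans (untouched-above ≤-refl) (trans (pegOf-unmoved q₁ low₁ (m<n⇒m<1+n ≤-refl)) w-top)

  Rigid : ℕ → Set
  Rigid j = ∀ {s t} (p : Path n s t) → MovesAtMost j p → ∀ {a b} → a ≢ b → Gathered j s a → Gathered j t b →
            len p ≤ optLength j → ∀ κ → countMoves κ p ≡ optCount j κ

  rigid-one : Rigid 1
  rigid-one p low a≢b gs gt short κ with transfer-decomposes 0 p a≢b gs gt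
  ... | decomposition p₁ _ k 0<k m p₂ with movesAtMost-++ p₁ (step k m p₂) low
  ...   | _ , k≤1 , _ with ≤-antisym k≤1 0<k
  ...     | refl = begin
    countMoves κ (p₁ ++ₚ step 1 m p₂)            ≡⟨ countMoves-split κ p₁ 1 m p₂ ⟩
    countMoves κ p₁ + (δ κ 1 + countMoves κ p₂)  ≡⟨ cong₂ (λ x y → x + (δ κ 1 + y))
                                                          (countMoves-empty κ p₁ (m+n≤o⇒m≤o _ rest))
                                                          (countMoves-empty κ p₂ (m+n≤o⇒n≤o (len p₁) rest)) ⟩
    δ κ 1 + 0                                    ≡⟨ +-identityʳ _ ⟩
    δ κ 1                                        ∎
    where
    open ≡-Reasoning
    rest : len p₁ + len p₂ ≤ 0
    rest = ≤-pred (subst (_≤ 1) (trans (len-split p₁ 1 m p₂) (+-suc (len p₁) (len p₂))) short)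

  top-move-source : ∀ {j s u w} (p₁ : Path n s u) → MovesAtMost j p₁ → ∀ {a} → Gathered (suc j) s a →
                    (mv : Move (suc j) u w) → Move.X mv ≡ a
  top-move-source p₁ low₁ gs mv = trans (sym (Move.source mv)) (trans (pegOf-unmoved p₁ low₁ ≤-refl) (gathered-top gs))

  prefix-lowerBound : ∀ {j s u w} (p₁ : Path n s u) → MovesAtMost j p₁ → ∀ {a} → Gathered (suc j) s a →
                      (mv : Move (suc j) u w) → optLength j ≤ len p₁
  prefix-lowerBound p₁ low₁ gs mv =
    transfer-lowerBound _ p₁ low₁ (λ a≡Y → Move.X≢Y mv (trans (top-move-source p₁ low₁ gs mv) a≡Y))
                        (gathered-≤ (n≤1+n _) gs) (smaller-gathered mv)

  top-move-lands : ∀ i {s u w t} (p₁ : Path n s u) (mv : Move (suc (suc i)) u w) (p₂ : Path n w t) →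
                   MovesAtMost (suc i) p₁ → MovesAtMost (suc (suc i)) p₂ →
                   ∀ {a b} → a ≢ b → Gathered (suc (suc i)) s a → Gathered (suc (suc i)) t b →
                   len p₁ + suc (len p₂) ≤ optLength (suc (suc i)) → Move.Z mv ≡ b
  top-move-lands i p₁ mv p₂ low₁ low₂ {a} {b} a≢b gs gt short with Move.Y mv ≟ₚ b
  ... | no Y≢b = trans (third-unique X Y Z X≢Y (X≢Z ∘ sym) (Y≢Z ∘ sym)) (sym (third-unique X Y b X≢Y b≢X (Y≢b ∘ sym)))
    where
    open Move mv
    b≢X : b ≢ X
    b≢X b≡X = a≢b (trans (sym (top-move-source p₁ low₁ gs mv)) (sym b≡X))
  ... | yes Y≡b = ⊥-elim (<-irrefl refl (begin-strict
    suc (T₁ + T₁)          <⟨ n<1+n _ ⟩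
    suc (suc (T₁ + T₁))    ≡⟨ trans (+-suc T₁ (suc T₁)) (cong suc (+-suc T₁ T₁)) ⟨
    T₁ + suc (suc T₁)      ≤⟨ +-mono-≤ (prefix-lowerBound p₁ low₁ gs mv) (s≤s second-half) ⟩
    len p₁ + suc (len p₂)  ≤⟨ short ⟩
    suc (optLength i + T₁) ≤⟨ s≤s (+-monoˡ-≤ T₁ (optLength-mono i)) ⟩
    suc (T₁ + T₁)          ∎))
    where
    open Move mv
    open ≤-Reasoning
    T₁ : ℕ
    T₁ = optLength (suc i)
    second-half : suc T₁ ≤ len p₂
    second-half = ≤-trans (potential-after-move-away mv (λ Z≡b → Y≢Z (trans Y≡b (sym Z≡b))))
                          (potential≤len (suc (suc i)) p₂ low₂ gt)

  rigid-step : ∀ i → Rigid i → Rigid (suc i) → Rigid (suc (suc i))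
  rigid-step i rigid₀ rigid₁ p low {a} {b} a≢b gs gt short κ with transfer-decomposes (suc i) p a≢b gs gt
  ... | decomposition {u} {w} p₁ low₁ k 1+i<k m p₂ with movesAtMost-++ p₁ (step k m p₂) low
  ...   | _ , k≤2+i , low₂ with ≤-antisym k≤2+i 1+i<k
  ...     | refl = begin
    countMoves κ (p₁ ++ₚ step (suc (suc i)) m p₂)           ≡⟨ countMoves-split κ p₁ _ m p₂ ⟩
    countMoves κ p₁ + (δ κ (suc (suc i)) + countMoves κ p₂) ≡⟨ cong₂ (λ x y → x + (δ κ (suc (suc i)) + y))
         (rigid₁ p₁ low₁ a≢Y (gathered-≤ (n≤1+n _) gs) (smaller-gathered mv) (proj₁ tight) κ)
         (rigid₀ p₂ low₂′ Y≢b (remaining-gathered mv) (gathered-≤ (m≤n⇒m≤1+n (n≤1+n i)) gt) (proj₂ tight) κ) ⟩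
    optCount (suc i) κ + (δ κ (suc (suc i)) + optCount i κ) ∎
    where
    open ≡-Reasoning
    mv : Move (suc (suc i)) u w
    mv = toMove {suc (suc i)} {u} {w} m
    open Move mv
    short′ : len p₁ + suc (len p₂) ≤ suc (optLength i + optLength (suc i))
    short′ = subst (_≤ _) (len-split p₁ _ m p₂) short
    a≢Y : a ≢ Y
    a≢Y a≡Y = X≢Y (trans (top-move-source p₁ low₁ gs mv) a≡Y)
    Z≡b : Z ≡ b
    Z≡b = top-move-lands i p₁ mv p₂ low₁ low₂ a≢b gs gt short′
    Y≢b : Y ≢ b
    Y≢b Y≡b = Y≢Z (trans Y≡b (sym Z≡b))
    second-half : optLength i ≤ len p₂
    second-half = subst (_≤ len p₂) (potential-after-move-home mv Z≡b) (potential≤len (suc (suc i)) p₂ low₂ gt)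
    sum-bound : len p₁ + len p₂ ≤ optLength (suc i) + optLength i
    sum-bound = ≤-pred (≤-trans (≤-reflexive (sym (+-suc (len p₁) (len p₂))))
                                (≤-trans short′ (≤-reflexive (cong suc (+-comm (optLength i) _)))))
    tight : len p₁ ≤ optLength (suc i) × len p₂ ≤ optLength i
    tight = +-tight sum-bound (prefix-lowerBound p₁ low₁ gs mv) second-half
    low₂′ : MovesAtMost i p₂
    low₂′ = settled-below i p₂ low₂ (trans (target (suc i) (s≤s z≤n) (inj₂ refl)) Z≡b) (trans target-top Z≡b)
                          gt (proj₂ tight)

  rigid : ∀ j → Rigid j
  rigid zero p _ _ _ _ short κ = countMoves-empty κ p short
  rigid (suc zero) = rigid-one
  rigid (suc (suc i)) = rigid-step i (rigid i) (rigid (suc i))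

theorem2p4 : (n k : ℕ) → 1 ≤ k → k ≤ n →
    Σ (Solution n) Optimal ×
    (∀ (p : Solution n) → Optimal p → countMoves k p ≡ fib (n + 1 ∸ k))
theorem2p4 n k 1≤k _ = (path , optimal) , λ p p-optimal → begin
  countMoves k p  ≡⟨ rigid n p (movesAtMost-n p) 0≢2 start-gathered goal-gathered
                           (≤-trans (p-optimal path) (≤-reflexive path-length)) k ⟩
  optCount n k    ≡⟨ optCount-fib n k 1≤k ⟩
  fib (suc n ∸ k) ≡⟨ cong (λ m → fib (m ∸ k)) (+-comm 1 n) ⟩
  fib (n + 1 ∸ k) ∎
  where
  open Hanoi n
  open ≡-Reasoning
  0≢2 : fz ≢ fs (fs fz)
  0≢2 ()
  start-gathered : Gathered n (start n) fz
  start-gathered = replicate-gathered n fz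
  goal-gathered : Gathered n (goal n) (fs (fs fz))
  goal-gathered = replicate-gathered n (fs (fs fz))
  open Transfer (transfer n ≤-refl 0≢2 start-gathered goal-gathered
                         (λ d n<d → trans (pegOf-beyond _ n<d) (sym (pegOf-beyond _ n<d))))
  optimal : Optimal path
  optimal q = subst (_≤ len q) (sym path-length)
                    (transfer-lowerBound n q (movesAtMost-n q) 0≢2 start-gathered goal-gathered)
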